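{- Let $G$ be a finite simple graph with $n$ vertices, let $k$ and $r$ be natural numbers with $k\leq r$, and suppose $V(G)=V_1\cup V_2\cup\dots\cup V_r$ with $V_i\cap V_j=\emptyset$ for $i\neq j$, where each $V_i$ is a $\delta_k$-small set of $G$. Then (i) $D_k(G)\leq\frac{n(r-1)}{r}$; (ii) $r\geq\frac{n}{n-D_k(G)}$.
   Context: Let $d(v)$ denote the degree of $v$. For nonempty $W\subseteq V(G)$ and natural $k$, $D_k(W)=\left(\frac{1}{|W|}\sum_{v\in W}d^k(v)\right)^{1/k}$ and $D_k(G)=D_k(V(G))$. $W$ is a $\delta_k$-small set of $G$ if $D_k(W)\leq n-|W|$. -}

module Defs where

open import Data.Bool using (Bool; true; false; if_then_else_)
open import Data.Nat as ℕ using (ℕ; _∸_; _≤_)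
open import Data.Fin using (Fin; _≟_)
open import Data.List using (map)
open import Data.Nat.ListAction using (sum)
open import Data.List.Base using (allFin)
open import Data.Integer using (+_)
open import Data.Rational as ℚ using (ℚ; 0ℚ; 1ℚ; _/_; _*_; _÷_; Positive)
open import Data.Rational.Properties using (pos⇒nonZero)
open import Data.Product using (Σ; _×_)
open import Data.Sum using (_⊎_)
open import Relation.Binary.PropositionalEquality using (_≡_)
open import Relation.Nullary.Decidable using (⌊_⌋)

record SimpleGraph (n : ℕ) : Set where
  field
    Adj    : Fin n → Fin n → Bool
    sym    : ∀ u v → Adj u v ≡ Adj v u
    irrefl : ∀ v → Adj v v ≡ false
open SimpleGraph public

sumV : {n : ℕ} → (Fin n → ℕ) → ℕ
sumV {n} f = sum (map f (allFin n))

degree : {n : ℕ} → SimpleGraph n → Fin n → ℕ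
degree G v = sumV (λ u → if Adj G v u then 1 else 0)

VSet : ℕ → Set
VSet n = Fin n → Bool

allV : {n : ℕ} → VSet n
allV _ = true

size : {n : ℕ} → VSet n → ℕ
size W = sumV (λ v → if W v then 1 else 0)

powSum : {n : ℕ} → SimpleGraph n → ℕ → VSet n → ℕ
powSum G k W = sumV (λ v → if W v then degree G v ℕ.^ k else 0)

toℚ : ℕ → ℚ
toℚ m = + m / 1

_^ℚ_ : ℚ → ℕ → ℚ
q ^ℚ ℕ.zero = 1ℚ
q ^ℚ ℕ.suc k = q * (q ^ℚ k)

-- D_k(W) = ((1/|W|) Σ_{v∈W} d(v)^k)^{1/k} is a (generally irrational) real
-- number.  It is compared with rationals q through the monotonicity of x ↦ x^k
-- on [0,∞) (for k ≥ 1 and nonempty W):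
--   D_k(W) ≤ q  ⇔  q ≥ 0  and  Σ_{v∈W} d(v)^k ≤ |W| · q^k
--   q ≤ D_k(W)  ⇔  q ≤ 0  or   |W| · q^k ≤ Σ_{v∈W} d(v)^k
DkLe : {n : ℕ} → SimpleGraph n → ℕ → VSet n → ℚ → Set
DkLe G k W q = (0ℚ ℚ.≤ q) × (toℚ (powSum G k W) ℚ.≤ toℚ (size W) * (q ^ℚ k))

GeDk : {n : ℕ} → SimpleGraph n → ℕ → VSet n → ℚ → Set
GeDk G k W q = (q ℚ.≤ 0ℚ) ⊎ (toℚ (size W) * (q ^ℚ k) ℚ.≤ toℚ (powSum G k W))

δSmall : {n : ℕ} → SimpleGraph n → ℕ → VSet n → Set
δSmall {n} G k W = (1 ℕ.≤ size W) × DkLe G k W (toℚ (n ∸ size W))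

classOf : {n r : ℕ} → (Fin n → Fin r) → Fin r → VSet n
classOf part i v = ⌊ part v ≟ i ⌋

divPos : (a b : ℚ) → 0ℚ ℚ.< b → ℚ
divPos a b h = _÷_ a b {{pos⇒nonZero b {{ℚ.positive h}}}}

module Submission where

-- Theorem 3.2.  Write V_1, …, V_r for the classes, a_i = |V_i|, b_i = n - a_i and
-- S = Σ_v d(v)^k.  δ_k-smallness of V_i says Σ_{v∈V_i} d(v)^k ≤ a_i b_i^k, so
-- S ≤ Σ_i a_i b_i^k, where Σ a_i = n.  Scaling by r (T = r n, U_i = r b_i, Q = (r-1) n)
-- turns the right-hand side into Σ_i (T - U_i) U_i^k with Σ U_i = r Q.  The function
-- φ(U) = (T - U) U^k is not concave on [0,T], but it lies below its tangent at Q as soon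
-- as k ≤ r (the gap is (U-Q)² times a polynomial whose sign the condition k ≤ r controls).
-- Summing the tangent inequalities, the linear terms cancel and r^k S ≤ n ((r-1) n)^k,
-- which is (i).  For (ii), q ≤ D_k(G) and (i) give r q ≤ (r-1) n, i.e. n ≤ r (n - q).

open import Data.Fin using (Fin; _≟_) renaming (zero to fzero; suc to fsuc)
open import Relation.Binary.PropositionalEquality
open import Function using (_∘_)
import Data.Nat.Properties as ℕP
import Data.Integer.Properties as ℤP
import Algebra.Properties.Semiring.Sum as SemiringSum

module ℕΣ = SemiringSum ℕP.+-*-semiring
module ℤΣ = SemiringSum ℤP.+-*-semiring
open ℕΣ using () renaming (sum to ∑ℕ)
open ℤΣ using () renaming (sum to ∑ℤ)

module TangentLine where

  open import Data.Nat as ℕ using (ℕ; zero; suc)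
  open import Data.Integer using (ℤ; +_; 0ℤ; 1ℤ; _+_; _*_; _-_; -_; _^_; _≤_; +≤+; nonNegative)
  open import Data.Integer.Tactic.RingSolver using (solve-∀)
  open import Data.Sum using (inj₁; inj₂)

  *-nonNeg : ∀ {x y} → 0ℤ ≤ x → 0ℤ ≤ y → 0ℤ ≤ x * y
  *-nonNeg {x} {y} 0≤x 0≤y =
    subst (_≤ x * y) (ℤP.*-zeroˡ y) (ℤP.*-monoʳ-≤-nonNeg y {{nonNegative 0≤y}} 0≤x)

  ^-nonNeg : ∀ x j → 0ℤ ≤ x → 0ℤ ≤ x ^ j
  ^-nonNeg x zero    _   = +≤+ ℕ.z≤n
  ^-nonNeg x (suc j) 0≤x = *-nonNeg 0≤x (^-nonNeg x j 0≤x)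

  square-nonNeg : ∀ x → 0ℤ ≤ x * x
  square-nonNeg x with ℤP.≤-total 0ℤ x
  ... | inj₁ 0≤x = *-nonNeg 0≤x 0≤x
  ... | inj₂ x≤0 = subst (0ℤ ≤_) (neg-square x) (*-nonNeg 0≤-x 0≤-x)
    where
      0≤-x : 0ℤ ≤ - x
      0≤-x = ℤP.neg-mono-≤ x≤0
      neg-square : ∀ x → - x * - x ≡ x * x
      neg-square = solve-∀

  -- The quotient  P_j(U,Q) = Σ_{i<j} (i+1) Q^i U^(j-1-i), in Horner form.
  taylorQuotient : ℤ → ℤ → ℕ → ℤ
  taylorQuotient U Q zero    = 0ℤ
  taylorQuotient U Q (suc j) = U * taylorQuotient U Q j + + suc j * Q ^ j

  taylor : ∀ U Q j →
    U ^ suc j ≡ Q ^ suc j + + suc j * Q ^ j * (U - Q) + (U - Q) * (U - Q) * taylorQuotient U Q j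
  taylor U Q zero    = base U Q
    where
      base : ∀ U Q → U * 1ℤ ≡ Q * 1ℤ + 1ℤ * 1ℤ * (U - Q) + (U - Q) * (U - Q) * 0ℤ
      base = solve-∀
  taylor U Q (suc j) = begin
    U * U ^ suc j                                  ≡⟨ cong (U *_) (taylor U Q j) ⟩
    U * (Q * Y + K * Y * (U - Q) + (U - Q) * (U - Q) * P)
                                                   ≡⟨ step U Q Y K P ⟩
    Q * (Q * Y) + (+ 1 + K) * (Q * Y) * (U - Q) + (U - Q) * (U - Q) * (U * P + K * Y) ∎
    where
      open ≡-Reasoning
      K Y P : ℤ
      K = + suc j
      Y = Q ^ j
      P = taylorQuotient U Q j
      step : ∀ U Q Y K P → U * (Q * Y + K * Y * (U - Q) + (U - Q) * (U - Q) * P)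
           ≡ Q * (Q * Y) + (+ 1 + K) * (Q * Y) * (U - Q) + (U - Q) * (U - Q) * (U * P + K * Y)
      step = solve-∀

  -- Under  0 ≤ U ≤ T  and  0 ≤ j·(T-Q) ≤ Q  the Taylor remainder is controlled:
  -- (T-U) P_j(U,Q) ≤ (j+1) Q^j.  (This is where the hypothesis k ≤ r enters.)
  quotient-bound : ∀ T U Q j → 0ℤ ≤ U → 0ℤ ≤ T - U → 0ℤ ≤ Q → 0ℤ ≤ T - Q → + j * (T - Q) ≤ Q
    → (T - U) * taylorQuotient U Q j ≤ + suc j * Q ^ j
  quotient-bound T U Q zero _ _ _ _ _ =
    subst (_≤ 1ℤ * 1ℤ) (sym (ℤP.*-zeroʳ (T - U))) (+≤+ ℕ.z≤n)
  quotient-bound T U Q (suc j) 0≤U 0≤T-U 0≤Q 0≤T-Q hyp = begin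
    (T - U) * (U * P + K * Y)            ≡⟨ expand T U P K Y ⟩
    U * ((T - U) * P) + K * Y * (T - U)  ≤⟨ ℤP.+-monoˡ-≤ (K * Y * (T - U)) (ℤP.*-monoˡ-≤-nonNeg U {{nonNegative 0≤U}} ih) ⟩
    U * (K * Y) + K * Y * (T - U)        ≡⟨ collect T U K Y ⟩
    K * T * Y                            ≤⟨ ℤP.*-monoʳ-≤-nonNeg Y {{nonNegative (^-nonNeg Q j 0≤Q)}} KT≤[1+K]Q ⟩
    (+ 1 + K) * Q * Y                    ≡⟨ ℤP.*-assoc (+ 1 + K) Q Y ⟩
    (+ 1 + K) * (Q * Y)                  ∎
    where
      open ℤP.≤-Reasoning
      K Y P : ℤ
      K = + suc j
      Y = Q ^ j
      P = taylorQuotient U Q j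
      ih : (T - U) * P ≤ K * Y
      ih = quotient-bound T U Q j 0≤U 0≤T-U 0≤Q 0≤T-Q
             (ℤP.≤-trans (ℤP.*-monoʳ-≤-nonNeg (T - Q) {{nonNegative 0≤T-Q}} (+≤+ (ℕP.n≤1+n j))) hyp)
      KT≤[1+K]Q : K * T ≤ (+ 1 + K) * Q
      KT≤[1+K]Q = begin
        K * T               ≡⟨ split K T Q ⟩
        K * Q + K * (T - Q) ≤⟨ ℤP.+-monoʳ-≤ (K * Q) hyp ⟩
        K * Q + Q           ≡⟨ join K Q ⟩
        (+ 1 + K) * Q       ∎
        where
          split : ∀ K T Q → K * T ≡ K * Q + K * (T - Q)
          split = solve-∀
          join : ∀ K Q → K * Q + Q ≡ (+ 1 + K) * Q
          join = solve-∀
      expand : ∀ T U P K Y → (T - U) * (U * P + K * Y) ≡ U * ((T - U) * P) + K * Y * (T - U)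
      expand = solve-∀
      collect : ∀ T U K Y → U * (K * Y) + K * Y * (T - U) ≡ K * T * Y
      collect = solve-∀

  -- The derivative of φ(U) = (T-U) U^(j+1) at U = Q.
  slope : ℤ → ℤ → ℕ → ℤ
  slope T Q j = Q ^ j * (+ suc j * T - + suc (suc j) * Q)

  -- Tangent-line inequality: on 0 ≤ U ≤ T the graph of φ lies below its tangent at Q,
  -- because the gap equals (U-Q)² ((j+1)Q^j - (T-U) P_j(U,Q)).
  tangent-line : ∀ T U Q j → 0ℤ ≤ U → 0ℤ ≤ T - U → 0ℤ ≤ Q → 0ℤ ≤ T - Q → + j * (T - Q) ≤ Q
    → (T - U) * U ^ suc j ≤ (T - Q) * Q ^ suc j + slope T Q j * (U - Q)
  tangent-line T U Q j 0≤U 0≤T-U 0≤Q 0≤T-Q hyp =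
    ℤP.0≤i-j⇒j≤i (subst (0ℤ ≤_) (sym gap)
      (*-nonNeg (square-nonNeg (U - Q)) (ℤP.i≤j⇒0≤j-i (quotient-bound T U Q j 0≤U 0≤T-U 0≤Q 0≤T-Q hyp))))
    where
      open ≡-Reasoning
      K Y P tangent : ℤ
      K = + suc j
      Y = Q ^ j
      P = taylorQuotient U Q j
      tangent = (T - Q) * Q ^ suc j + slope T Q j * (U - Q)
      gap : tangent - (T - U) * U ^ suc j ≡ (U - Q) * (U - Q) * (K * Y - (T - U) * P)
      gap = begin
        tangent - (T - U) * U ^ suc j
          ≡⟨ cong (λ z → tangent - (T - U) * z) (taylor U Q j) ⟩
        tangent - (T - U) * (Q * Y + K * Y * (U - Q) + (U - Q) * (U - Q) * P)
          ≡⟨ identity T U Q Y K P ⟩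
        (U - Q) * (U - Q) * (K * Y - (T - U) * P) ∎
        where
          identity : ∀ T U Q Y K P →
            (T - Q) * (Q * Y) + Y * (K * T - (+ 1 + K) * Q) * (U - Q)
              - (T - U) * (Q * Y + K * Y * (U - Q) + (U - Q) * (U - Q) * P)
            ≡ (U - Q) * (U - Q) * (K * Y - (T - U) * P)
          identity = solve-∀

module NaturalSums where

  open import Defs using (sumV; classOf)
  open import Data.Nat using (ℕ; zero; suc; _+_; _*_; _≤_; z≤n)
  open import Data.Bool using (if_then_else_)
  open import Data.List using (tabulate)
  open import Data.List.Properties using (map-tabulate)
  import Data.Nat.ListAction as List
  open import Relation.Nullary.Decidable using (⌊_⌋; yes; no)

  sumV≡∑ : ∀ {n} (f : Fin n → ℕ) → sumV f ≡ ∑ℕ f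
  sumV≡∑ {n} f = trans (cong List.sum (map-tabulate (λ v → v) f)) (list-sum f)
    where
      list-sum : ∀ {m} (g : Fin m → ℕ) → List.sum (tabulate g) ≡ ∑ℕ g
      list-sum {zero}  g = refl
      list-sum {suc m} g = cong (g fzero +_) (list-sum (g ∘ fsuc))

  ∑-const : ∀ {m} c → ∑ℕ {m} (λ _ → c) ≡ m * c
  ∑-const {zero}  c = refl
  ∑-const {suc m} c = cong (c +_) (∑-const {m} c)

  ∑-mono : ∀ {m} {f g : Fin m → ℕ} → (∀ i → f i ≤ g i) → ∑ℕ f ≤ ∑ℕ g
  ∑-mono {zero}  f≤g = z≤n
  ∑-mono {suc m} f≤g = ℕP.+-mono-≤ (f≤g fzero) (∑-mono (f≤g ∘ fsuc))

  ∑-indicator : ∀ {r} (j : Fin r) c → ∑ℕ (λ i → if ⌊ j ≟ i ⌋ then c else 0) ≡ c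
  ∑-indicator {suc r} fzero    c = trans (cong (c +_) (ℕΣ.sum-replicate-zero r)) (ℕP.+-identityʳ c)
  ∑-indicator {suc r} (fsuc j) c = trans (ℕΣ.sum-cong-≗ {r} λ i → cong (λ b → if b then c else 0) (suc-test i))
                                         (∑-indicator j c)
    where
      suc-test : ∀ i → ⌊ fsuc j ≟ fsuc i ⌋ ≡ ⌊ j ≟ i ⌋
      suc-test i with j ≟ i
      ... | yes _ = refl
      ... | no  _ = refl

  ∑-partition : ∀ {n r} (part : Fin n → Fin r) (g : Fin n → ℕ)
    → ∑ℕ (λ i → sumV (λ v → if classOf part i v then g v else 0)) ≡ sumV g
  ∑-partition {n} {r} part g = begin
    ∑ℕ (λ i → sumV (λ v → restricted i v))  ≡⟨ ℕΣ.sum-cong-≗ {r} (λ i → sumV≡∑ (restricted i)) ⟩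
    ∑ℕ (λ i → ∑ℕ (λ v → restricted i v))    ≡⟨ ℕΣ.∑-comm restricted ⟩
    ∑ℕ (λ v → ∑ℕ (λ i → restricted i v))    ≡⟨ ℕΣ.sum-cong-≗ {n} (λ v → ∑-indicator (part v) (g v)) ⟩
    ∑ℕ g                                    ≡⟨ sumV≡∑ g ⟨
    sumV g                                  ∎
    where
      open ≡-Reasoning
      restricted : Fin r → Fin n → ℕ
      restricted i v = if classOf part i v then g v else 0

  complement-sum : ∀ {r'} n (a b : Fin (suc r') → ℕ) → (∀ i → a i + b i ≡ n) → ∑ℕ a ≡ n
    → ∑ℕ b ≡ n * r'
  complement-sum {r'} n a b a+b≡n ∑a≡n = ℕP.+-cancelˡ-≡ n _ _ (begin
    n + ∑ℕ b              ≡⟨ cong (_+ ∑ℕ b) ∑a≡n ⟨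
    ∑ℕ a + ∑ℕ b           ≡⟨ ℕΣ.∑-distrib-+ a b ⟨
    ∑ℕ (λ i → a i + b i)  ≡⟨ ℕΣ.sum-cong-≗ {suc r'} a+b≡n ⟩
    ∑ℕ {suc r'} (λ _ → n) ≡⟨ ∑-const {suc r'} n ⟩
    n + r' * n            ≡⟨ cong (n +_) (ℕP.*-comm r' n) ⟩
    n + n * r'            ∎)
    where open ≡-Reasoning

module TangentSums where

  open import Data.Nat as ℕ using (ℕ; zero; suc)
  open import Data.Integer using (ℤ; +_; 0ℤ; _+_; _*_; _-_; _^_; _≤_; +≤+)
  open import Data.Integer.Tactic.RingSolver using (solve-∀)
  open TangentLine using (tangent-line; slope)

  ∑-cast : ∀ {m} (f : Fin m → ℕ) → + ∑ℕ f ≡ ∑ℤ (λ i → + f i)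
  ∑-cast {zero}  f = refl
  ∑-cast {suc m} f = trans (ℤP.pos-+ (f fzero) (∑ℕ (f ∘ fsuc))) (cong (_+_ (+ f fzero)) (∑-cast (f ∘ fsuc)))

  ^-cast : ∀ m k → + (m ℕ.^ k) ≡ (+ m) ^ k
  ^-cast m zero    = refl
  ^-cast m (suc k) = trans (ℤP.pos-* m (m ℕ.^ k)) (cong (+ m *_) (^-cast m k))

  ∑-affine-bound : ∀ {m} (f U : Fin m → ℤ) c₀ c₁ Q → (∀ i → f i ≤ c₀ + c₁ * (U i - Q))
    → ∑ℤ f ≤ + m * c₀ + c₁ * (∑ℤ U - + m * Q)
  ∑-affine-bound {zero}  f U c₀ c₁ Q bound = ℤP.≤-reflexive (empty c₀ c₁ Q)
    where
      empty : ∀ c₀ c₁ Q → 0ℤ ≡ 0ℤ * c₀ + c₁ * (0ℤ - 0ℤ * Q)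
      empty = solve-∀
  ∑-affine-bound {suc m} f U c₀ c₁ Q bound = ℤP.≤-trans
    (ℤP.+-mono-≤ (bound fzero) (∑-affine-bound (f ∘ fsuc) (U ∘ fsuc) c₀ c₁ Q (bound ∘ fsuc)))
    (ℤP.≤-reflexive (regroup (+ m) c₀ c₁ Q (U fzero) (∑ℤ (U ∘ fsuc))))
    where
      regroup : ∀ M c₀ c₁ Q u S → (c₀ + c₁ * (u - Q)) + (M * c₀ + c₁ * (S - M * Q))
              ≡ (+ 1 + M) * c₀ + c₁ * ((u + S) - (+ 1 + M) * Q)
      regroup = solve-∀

  -- Jensen-type inequality for φ(U) = (T-U) U^(j+1): if m points U_i ∈ [0,T] have mean Q
  -- and 0 ≤ j (T-Q) ≤ Q, then Σ φ(U_i) ≤ m φ(Q); the linear parts of the tangents cancel.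
  tangent-sum : ∀ {m} T Q j (U : Fin m → ℤ) → (∀ i → 0ℤ ≤ U i) → (∀ i → 0ℤ ≤ T - U i)
    → 0ℤ ≤ Q → 0ℤ ≤ T - Q → + j * (T - Q) ≤ Q → ∑ℤ U ≡ + m * Q
    → ∑ℤ (λ i → (T - U i) * U i ^ suc j) ≤ + m * ((T - Q) * Q ^ suc j)
  tangent-sum {m} T Q j U 0≤U 0≤T-U 0≤Q 0≤T-Q hyp mean = begin
    ∑ℤ (λ i → (T - U i) * U i ^ suc j)     ≤⟨ ∑-affine-bound _ U c₀ c₁ Q tangents ⟩
    + m * c₀ + c₁ * (∑ℤ U - + m * Q)       ≡⟨ cong (λ s → + m * c₀ + c₁ * (s - + m * Q)) mean ⟩
    + m * c₀ + c₁ * (+ m * Q - + m * Q)    ≡⟨ linear-part-vanishes (+ m) c₀ c₁ Q ⟩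
    + m * c₀                               ∎
    where
      open ℤP.≤-Reasoning
      c₀ c₁ : ℤ
      c₀ = (T - Q) * Q ^ suc j
      c₁ = slope T Q j
      tangents : ∀ i → (T - U i) * U i ^ suc j ≤ c₀ + c₁ * (U i - Q)
      tangents i = tangent-line T (U i) Q j (0≤U i) (0≤T-U i) 0≤Q 0≤T-Q hyp
      linear-part-vanishes : ∀ M c₀ c₁ Q → M * c₀ + c₁ * (M * Q - M * Q) ≡ M * c₀
      linear-part-vanishes = solve-∀

  pos-+-minus : ∀ p q → + (p ℕ.+ q) - + q ≡ + p
  pos-+-minus p q = trans (cong (_- + q) (ℤP.pos-+ p q)) (add-sub (+ p) (+ q))
    where
      add-sub : ∀ u v → u + v - v ≡ u
      add-sub = solve-∀

  tangent-sumℕ : ∀ {m} d q j (c u : Fin m → ℕ) → (∀ i → c i ℕ.+ u i ≡ d ℕ.+ q)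
    → ∑ℕ u ≡ m ℕ.* q → j ℕ.* d ℕ.≤ q
    → ∑ℕ (λ i → c i ℕ.* u i ℕ.^ suc j) ℕ.≤ m ℕ.* (d ℕ.* q ℕ.^ suc j)
  tangent-sumℕ {m} d q j c u c+u≡d+q ∑u≡mq jd≤q = ℤP.drop‿+≤+ (begin
    + ∑ℕ (λ i → c i ℕ.* u i ℕ.^ k)       ≡⟨ ∑-cast (λ i → c i ℕ.* u i ℕ.^ k) ⟩
    ∑ℤ (λ i → + (c i ℕ.* u i ℕ.^ k))     ≡⟨ ℤΣ.sum-cong-≗ {m} term-cast ⟩
    ∑ℤ (λ i → (T - U i) * U i ^ k)       ≤⟨ tangent-sum T Q j U 0≤U 0≤T-U 0≤Q 0≤T-Q hyp mean ⟩
    + m * ((T - Q) * Q ^ k)              ≡⟨ cong (λ t → + m * (t * Q ^ k)) (pos-+-minus d q) ⟩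
    + m * (+ d * Q ^ k)                  ≡⟨ cast-product ⟩
    + (m ℕ.* (d ℕ.* q ℕ.^ k))            ∎)
    where
      open ℤP.≤-Reasoning
      k : ℕ
      k = suc j
      T Q : ℤ
      T = + (d ℕ.+ q)
      Q = + q
      U : Fin m → ℤ
      U i = + u i
      T-U≡c : ∀ i → T - U i ≡ + c i
      T-U≡c i = trans (cong (λ t → + t - U i) (sym (c+u≡d+q i))) (pos-+-minus (c i) (u i))
      term-cast : ∀ i → + (c i ℕ.* u i ℕ.^ k) ≡ (T - U i) * U i ^ k
      term-cast i = trans (ℤP.pos-* (c i) (u i ℕ.^ k)) (cong₂ _*_ (sym (T-U≡c i)) (^-cast (u i) k))
      cast-product : + m * (+ d * Q ^ k) ≡ + (m ℕ.* (d ℕ.* q ℕ.^ k))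
      cast-product = sym (trans (ℤP.pos-* m (d ℕ.* q ℕ.^ k))
                       (cong (+ m *_) (trans (ℤP.pos-* d (q ℕ.^ k)) (cong (+ d *_) (^-cast q k)))))
      0≤U : ∀ i → 0ℤ ≤ U i
      0≤U i = +≤+ ℕ.z≤n
      0≤T-U : ∀ i → 0ℤ ≤ T - U i
      0≤T-U i = subst (0ℤ ≤_) (sym (T-U≡c i)) (+≤+ ℕ.z≤n)
      0≤Q : 0ℤ ≤ Q
      0≤Q = +≤+ ℕ.z≤n
      0≤T-Q : 0ℤ ≤ T - Q
      0≤T-Q = subst (0ℤ ≤_) (sym (pos-+-minus d q)) (+≤+ ℕ.z≤n)
      hyp : + j * (T - Q) ≤ Q
      hyp = subst (_≤ Q) (trans (ℤP.pos-* j d) (cong (+ j *_) (sym (pos-+-minus d q)))) (+≤+ jd≤q)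
      mean : ∑ℤ U ≡ + m * Q
      mean = trans (sym (∑-cast u)) (trans (cong +_ ∑u≡mq) (ℤP.pos-* m q))

module PowerSumBound where

  open import Data.Nat using (ℕ; zero; suc; _+_; _*_; _^_; _≤_)
  import Data.Nat.Tactic.RingSolver as ℕSolver
  open NaturalSums using (complement-sum)
  open TangentSums using (tangent-sumℕ)

  ^-distribʳ-* : ∀ m n k → (m * n) ^ k ≡ m ^ k * n ^ k
  ^-distribʳ-* m n zero    = refl
  ^-distribʳ-* m n (suc k) = trans (cong (m * n *_) (^-distribʳ-* m n k)) (interchange m n (m ^ k) (n ^ k))
    where
      interchange : ∀ m n p q → m * n * (p * q) ≡ m * p * (n * q)
      interchange = ℕSolver.solve-∀

  -- Scaling by r (c_i = r a_i, u_i = r b_i) puts the mean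
  -- n r' of the u_i on the integer grid, where tangent-sumℕ applies.
  powerSum-bound : ∀ {r'} n j (a b : Fin (suc r') → ℕ) → (∀ i → a i + b i ≡ n) → ∑ℕ a ≡ n
    → j ≤ r' → suc r' ^ suc j * ∑ℕ (λ i → a i * b i ^ suc j) ≤ n * (n * r') ^ suc j
  powerSum-bound {r'} n j a b a+b≡n ∑a≡n j≤r' = ℕP.*-cancelˡ-≤ R (begin
    R * (R ^ k * ∑ℕ (λ i → a i * b i ^ k))  ≡⟨ scale-in ⟩
    ∑ℕ (λ i → R * a i * (R * b i) ^ k)       ≤⟨ tangent-sumℕ n (n * r') j (λ i → R * a i) (λ i → R * b i) c+u≡ ∑u≡ jn≤nr' ⟩
    R * (n * (n * r') ^ k)                   ∎)
    where
      open ℕP.≤-Reasoning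
      R k : ℕ
      R = suc r'
      k = suc j
      c+u≡ : ∀ i → R * a i + R * b i ≡ n + n * r'
      c+u≡ i = begin-equality
        R * a i + R * b i  ≡⟨ ℕP.*-distribˡ-+ R (a i) (b i) ⟨
        R * (a i + b i)    ≡⟨ cong (R *_) (a+b≡n i) ⟩
        n + r' * n         ≡⟨ cong (n +_) (ℕP.*-comm r' n) ⟩
        n + n * r'         ∎
      ∑u≡ : ∑ℕ (λ i → R * b i) ≡ R * (n * r')
      ∑u≡ = trans (sym (ℕΣ.*-distribˡ-sum R b)) (cong (R *_) (complement-sum n a b a+b≡n ∑a≡n))
      jn≤nr' : j * n ≤ n * r'
      jn≤nr' = subst (j * n ≤_) (ℕP.*-comm r' n) (ℕP.*-monoˡ-≤ n j≤r')
      scale-term : ∀ i → R * (R ^ k * (a i * b i ^ k)) ≡ R * a i * (R * b i) ^ k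
      scale-term i = trans (regroup R (R ^ k) (a i) (b i ^ k)) (cong (R * a i *_) (sym (^-distribʳ-* R (b i) k)))
        where
          regroup : ∀ R Rk a bk → R * (Rk * (a * bk)) ≡ R * a * (Rk * bk)
          regroup = ℕSolver.solve-∀
      scale-in : R * (R ^ k * ∑ℕ (λ i → a i * b i ^ k)) ≡ ∑ℕ (λ i → R * a i * (R * b i) ^ k)
      scale-in = begin-equality
        R * (R ^ k * ∑ℕ (λ i → a i * b i ^ k))   ≡⟨ cong (R *_) (ℕΣ.*-distribˡ-sum (R ^ k) (λ i → a i * b i ^ k)) ⟩
        R * ∑ℕ (λ i → R ^ k * (a i * b i ^ k))   ≡⟨ ℕΣ.*-distribˡ-sum R (λ i → R ^ k * (a i * b i ^ k)) ⟩
        ∑ℕ (λ i → R * (R ^ k * (a i * b i ^ k))) ≡⟨ ℕΣ.sum-cong-≗ {R} scale-term ⟩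
        ∑ℕ (λ i → R * a i * (R * b i) ^ k)       ∎

module Rationals where

  open import Defs using (toℚ; _^ℚ_; divPos)
  open import Data.Nat as ℕ using (ℕ; zero; suc)
  import Data.Nat.Coprimality as Coprimality
  open import Data.Integer as ℤ using (+_; +≤+)
  open import Data.Rational using (ℚ; mkℚ; 0ℚ; 1ℚ; _/_; _+_; _*_; _-_; 1/_; _≤_; _<_; *≤*; *<*; toℚᵘ; NonZero; positive; nonNegative)
  open import Data.Rational.Properties as ℚP using (module ≤-Reasoning)
  open import Data.Rational.Solver using (module +-*-Solver)
  import Data.Rational.Unnormalised as ℚᵘ
  import Data.Rational.Unnormalised.Properties as ℚᵘP
  open import Relation.Nullary using (yes; no)
  open import Data.Empty using (⊥-elim)
  open +-*-Solver using (solve; _:+_; _:*_; _:-_; _:=_)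

  toℚ-mk : ∀ m → toℚ m ≡ mkℚ (+ m) 0 (Coprimality.sym (Coprimality.1-coprimeTo m))
  toℚ-mk m = ℚP.normalize-coprime (Coprimality.sym (Coprimality.1-coprimeTo m))

  toℚᵘ-toℚ : ∀ m → toℚᵘ (toℚ m) ≡ ℚᵘ.mkℚᵘ (+ m) 0
  toℚᵘ-toℚ m = cong toℚᵘ (toℚ-mk m)

  toℚ-mono-≤ : ∀ {a b} → a ℕ.≤ b → toℚ a ≤ toℚ b
  toℚ-mono-≤ {a} {b} a≤b rewrite toℚ-mk a | toℚ-mk b =
    *≤* (subst₂ ℤ._≤_ (sym (ℤP.*-identityʳ (+ a))) (sym (ℤP.*-identityʳ (+ b))) (+≤+ a≤b))

  toℚ-cancel-≤ : ∀ {a b} → toℚ a ≤ toℚ b → a ℕ.≤ b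
  toℚ-cancel-≤ {a} {b} a≤b rewrite toℚ-mk a | toℚ-mk b with a≤b
  ... | *≤* a≤b′ = ℤP.drop‿+≤+ (subst₂ ℤ._≤_ (ℤP.*-identityʳ (+ a)) (ℤP.*-identityʳ (+ b)) a≤b′)

  toℚ-pos : ∀ m → 1 ℕ.≤ m → 0ℚ < toℚ m
  toℚ-pos (suc m) _ rewrite toℚ-mk (suc m) = *<* (ℤ.+<+ (ℕ.s≤s ℕ.z≤n))

  toℚ-+ : ∀ a b → toℚ (a ℕ.+ b) ≡ toℚ a + toℚ b
  toℚ-+ a b = ℚP.toℚᵘ-injective (begin
    toℚᵘ (toℚ (a ℕ.+ b))                         ≡⟨ toℚᵘ-toℚ (a ℕ.+ b) ⟩
    ℚᵘ.mkℚᵘ (+ (a ℕ.+ b)) 0                      ≈⟨ ℚᵘ.*≡* (cong (ℤ._* + 1) (trans (ℤP.pos-+ a b)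
                                                       (cong₂ ℤ._+_ (sym (ℤP.*-identityʳ (+ a))) (sym (ℤP.*-identityʳ (+ b)))))) ⟩
    ℚᵘ.mkℚᵘ (+ a) 0 ℚᵘ.+ ℚᵘ.mkℚᵘ (+ b) 0         ≡⟨ cong₂ ℚᵘ._+_ (toℚᵘ-toℚ a) (toℚᵘ-toℚ b) ⟨
    toℚᵘ (toℚ a) ℚᵘ.+ toℚᵘ (toℚ b)               ≈⟨ ℚP.toℚᵘ-homo-+ (toℚ a) (toℚ b) ⟨
    toℚᵘ (toℚ a + toℚ b)                         ∎)
    where open ℚᵘP.≃-Reasoning

  toℚ-* : ∀ a b → toℚ (a ℕ.* b) ≡ toℚ a * toℚ b
  toℚ-* a b = ℚP.toℚᵘ-injective (begin
    toℚᵘ (toℚ (a ℕ.* b))                         ≡⟨ toℚᵘ-toℚ (a ℕ.* b) ⟩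
    ℚᵘ.mkℚᵘ (+ (a ℕ.* b)) 0                      ≈⟨ ℚᵘ.*≡* (cong (ℤ._* + 1) (ℤP.pos-* a b)) ⟩
    ℚᵘ.mkℚᵘ (+ a) 0 ℚᵘ.* ℚᵘ.mkℚᵘ (+ b) 0         ≡⟨ cong₂ ℚᵘ._*_ (toℚᵘ-toℚ a) (toℚᵘ-toℚ b) ⟨
    toℚᵘ (toℚ a) ℚᵘ.* toℚᵘ (toℚ b)               ≈⟨ ℚP.toℚᵘ-homo-* (toℚ a) (toℚ b) ⟨
    toℚᵘ (toℚ a * toℚ b)                         ∎)
    where open ℚᵘP.≃-Reasoning

  toℚ-^ : ∀ a k → toℚ (a ℕ.^ k) ≡ toℚ a ^ℚ k
  toℚ-^ a zero    = refl
  toℚ-^ a (suc k) = trans (toℚ-* a (a ℕ.^ k)) (cong (toℚ a *_) (toℚ-^ a k))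

  /-*-cancel : ∀ x r' → (+ x / suc r') * toℚ (suc r') ≡ toℚ x
  /-*-cancel x r' = ℚP.toℚᵘ-injective (begin
    toℚᵘ ((+ x / suc r') * toℚ (suc r'))                   ≈⟨ ℚP.toℚᵘ-homo-* (+ x / suc r') (toℚ (suc r')) ⟩
    toℚᵘ (+ x / suc r') ℚᵘ.* toℚᵘ (toℚ (suc r'))          ≈⟨ ℚᵘP.*-cong (ℚP.toℚᵘ-fromℚᵘ (ℚᵘ.mkℚᵘ (+ x) r'))
                                                                         (ℚP.toℚᵘ-fromℚᵘ (ℚᵘ.mkℚᵘ (+ suc r') 0)) ⟩
    ℚᵘ.mkℚᵘ (+ x) r' ℚᵘ.* ℚᵘ.mkℚᵘ (+ suc r') 0             ≈⟨ ℚᵘ.*≡* cancel ⟩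
    ℚᵘ.mkℚᵘ (+ x) 0                                        ≡⟨ toℚᵘ-toℚ x ⟨
    toℚᵘ (toℚ x)                                           ∎)
    where
      open ℚᵘP.≃-Reasoning
      cancel : + x ℤ.* + suc r' ℤ.* + 1 ≡ + x ℤ.* + (suc r' ℕ.* 1)
      cancel = trans (ℤP.*-identityʳ (+ x ℤ.* + suc r')) (cong (λ d → + x ℤ.* + d) (sym (ℕP.*-identityʳ (suc r'))))

  ^ℚ-distribʳ-* : ∀ p q k → (p * q) ^ℚ k ≡ p ^ℚ k * q ^ℚ k
  ^ℚ-distribʳ-* p q zero    = refl
  ^ℚ-distribʳ-* p q (suc k) = trans (cong (p * q *_) (^ℚ-distribʳ-* p q k)) (interchange p q (p ^ℚ k) (q ^ℚ k))
    where
      interchange : ∀ p q P Q → p * q * (P * Q) ≡ p * P * (q * Q)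
      interchange = solve 4 (λ p q P Q → p :* q :* (P :* Q) := p :* P :* (q :* Q)) refl

  ^ℚ-pos : ∀ p k → 0ℚ < p → 0ℚ < p ^ℚ k
  ^ℚ-pos p zero    _   = ℚP.positive⁻¹ 1ℚ
  ^ℚ-pos p (suc k) 0<p = ℚP.positive⁻¹ (p * p ^ℚ k)
    {{ℚP.pos*pos⇒pos p {{positive 0<p}} (p ^ℚ k) {{positive (^ℚ-pos p k 0<p)}}}}

  ^ℚ-nonNeg : ∀ p k → 0ℚ ≤ p → 0ℚ ≤ p ^ℚ k
  ^ℚ-nonNeg p zero    _   = ℚP.nonNegative⁻¹ 1ℚ
  ^ℚ-nonNeg p (suc k) 0≤p = ℚP.nonNegative⁻¹ (p * p ^ℚ k)
    {{ℚP.nonNeg*nonNeg⇒nonNeg p {{nonNegative 0≤p}} (p ^ℚ k) {{nonNegative (^ℚ-nonNeg p k 0≤p)}}}}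

  ^ℚ-mono-≤ : ∀ k {p q} → 0ℚ ≤ p → p ≤ q → p ^ℚ k ≤ q ^ℚ k
  ^ℚ-mono-≤ zero    _   _   = ℚP.≤-refl
  ^ℚ-mono-≤ (suc k) {p} {q} 0≤p p≤q = begin
    p * p ^ℚ k  ≤⟨ ℚP.*-monoˡ-≤-nonNeg p {{nonNegative 0≤p}} (^ℚ-mono-≤ k 0≤p p≤q) ⟩
    p * q ^ℚ k  ≤⟨ ℚP.*-monoʳ-≤-nonNeg (q ^ℚ k) {{nonNegative 0≤qᵏ}} p≤q ⟩
    q * q ^ℚ k  ∎
    where
      open ≤-Reasoning
      0≤qᵏ : 0ℚ ≤ q ^ℚ k
      0≤qᵏ = ^ℚ-nonNeg q k (ℚP.≤-trans 0≤p p≤q)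

  ^ℚ-mono-< : ∀ j {p q} → 0ℚ ≤ p → p < q → p ^ℚ suc j < q ^ℚ suc j
  ^ℚ-mono-< j {p} {q} 0≤p p<q = begin-strict
    p * p ^ℚ j  ≤⟨ ℚP.*-monoˡ-≤-nonNeg p {{nonNegative 0≤p}} (^ℚ-mono-≤ j 0≤p (ℚP.<⇒≤ p<q)) ⟩
    p * q ^ℚ j  <⟨ ℚP.*-monoˡ-<-pos (q ^ℚ j) {{positive (^ℚ-pos q j (ℚP.≤-<-trans 0≤p p<q))}} p<q ⟩
    q * q ^ℚ j  ∎
    where open ≤-Reasoning

  ^ℚ-cancel-≤ : ∀ j {p q} → 0ℚ ≤ q → p ^ℚ suc j ≤ q ^ℚ suc j → p ≤ q
  ^ℚ-cancel-≤ j {p} {q} 0≤q pᵏ≤qᵏ with p ℚP.≤? q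
  ... | yes p≤q = p≤q
  ... | no  p≰q = ⊥-elim (ℚP.<-irrefl refl (ℚP.<-≤-trans (^ℚ-mono-< j 0≤q (ℚP.≰⇒> p≰q)) pᵏ≤qᵏ))

  scaled-bound : ∀ s n x r' k → suc r' ℕ.^ k ℕ.* s ℕ.≤ n ℕ.* x ℕ.^ k
    → toℚ s ≤ toℚ n * (+ x / suc r') ^ℚ k
  scaled-bound s n x r' k rᵏs≤nxᵏ = ℚP.*-cancelʳ-≤-pos Rᵏ {{positive (^ℚ-pos R k (toℚ-pos (suc r') (ℕ.s≤s ℕ.z≤n)))}} (begin
    toℚ s * Rᵏ              ≡⟨ ℚP.*-comm (toℚ s) Rᵏ ⟩
    Rᵏ * toℚ s              ≡⟨ cong (_* toℚ s) (toℚ-^ (suc r') k) ⟨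
    toℚ (suc r' ℕ.^ k) * toℚ s ≡⟨ toℚ-* (suc r' ℕ.^ k) s ⟨
    toℚ (suc r' ℕ.^ k ℕ.* s) ≤⟨ toℚ-mono-≤ rᵏs≤nxᵏ ⟩
    toℚ (n ℕ.* x ℕ.^ k)     ≡⟨ trans (toℚ-* n (x ℕ.^ k)) (cong (toℚ n *_) (toℚ-^ x k)) ⟩
    toℚ n * toℚ x ^ℚ k      ≡⟨ cong (λ y → toℚ n * y ^ℚ k) (/-*-cancel x r') ⟨
    toℚ n * (X * R) ^ℚ k    ≡⟨ cong (toℚ n *_) (^ℚ-distribʳ-* X R k) ⟩
    toℚ n * (X ^ℚ k * Rᵏ)   ≡⟨ ℚP.*-assoc (toℚ n) (X ^ℚ k) Rᵏ ⟨
    toℚ n * X ^ℚ k * Rᵏ     ∎)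
    where
      open ≤-Reasoning
      R Rᵏ X : ℚ
      R = toℚ (suc r')
      Rᵏ = R ^ℚ k
      X = + x / suc r'

  -- If q ≤ n (r-1) / r (r = r'+1) and n - q > 0, then n / (n - q) ≤ r:
  -- indeed r (n - q) = r n - r q ≥ r n - (r-1) n = n.
  ratio-bound : ∀ n r' q (h : 0ℚ < toℚ n - q) → q ≤ + (n ℕ.* r') / suc r'
    → divPos (toℚ n) (toℚ n - q) h ≤ toℚ (suc r')
  ratio-bound n r' q h q≤X = ℚP.*-cancelʳ-≤-pos d {{positive h}} (begin
    divPos (toℚ n) d h * d     ≡⟨ ℚP.*-assoc (toℚ n) 1/d d ⟩
    toℚ n * (1/d * d)          ≡⟨ cong (toℚ n *_) (ℚP.*-inverseˡ d {{d≢0}}) ⟩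
    toℚ n * 1ℚ                 ≡⟨ ℚP.*-identityʳ (toℚ n) ⟩
    toℚ n                      ≡⟨ add-sub (toℚ n) (toℚ x) ⟨
    toℚ n + toℚ x - toℚ x      ≡⟨ cong (_- toℚ x) rn≡n+x ⟨
    R * toℚ n - toℚ x          ≤⟨ ℚP.+-monoʳ-≤ (R * toℚ n) (ℚP.neg-antimono-≤ rq≤x) ⟩
    R * toℚ n - R * q          ≡⟨ factor R (toℚ n) q ⟨
    R * d                      ∎)
    where
      open ≤-Reasoning
      x : ℕ
      x = n ℕ.* r'
      R d 1/d : ℚ
      R = toℚ (suc r')
      d = toℚ n - q
      d≢0 : NonZero d
      d≢0 = ℚP.pos⇒nonZero d {{positive h}}
      1/d = (1/ d) {{d≢0}}
      rq≤x : R * q ≤ toℚ x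
      rq≤x = begin
        R * q              ≤⟨ ℚP.*-monoˡ-≤-nonNeg R {{nonNegative (ℚP.<⇒≤ (toℚ-pos (suc r') (ℕ.s≤s ℕ.z≤n)))}} q≤X ⟩
        R * (+ x / suc r') ≡⟨ ℚP.*-comm R (+ x / suc r') ⟩
        (+ x / suc r') * R ≡⟨ /-*-cancel x r' ⟩
        toℚ x              ∎
      rn≡n+x : R * toℚ n ≡ toℚ n + toℚ x
      rn≡n+x = trans (sym (toℚ-* (suc r') n)) (trans (cong (λ m → toℚ (n ℕ.+ m)) (ℕP.*-comm r' n)) (toℚ-+ n x))
      add-sub : ∀ a b → a + b - b ≡ a
      add-sub = solve 2 (λ a b → a :+ b :- b := a) refl
      factor : ∀ R a q → R * (a - q) ≡ R * a - R * q
      factor = solve 3 (λ R a q → R :* (a :- q) := R :* a :- R :* q) refl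

module Partitions where

  open import Defs hiding (sym)
  open import Data.Nat using (ℕ; suc; _+_; _*_; _^_; _∸_; _≤_; z≤n; s≤s)
  open import Data.Bool using (true; false; if_then_else_)
  open import Data.Rational as ℚ using (ℚ)
  import Data.Rational.Properties as ℚP
  open import Data.Product using (_,_; proj₁)
  open import Data.Sum using (inj₁; inj₂)
  open NaturalSums
  open PowerSumBound
  open Rationals

  size≤n : ∀ {n} (W : VSet n) → size W ≤ n
  size≤n {n} W = begin
    size W                                  ≡⟨ sumV≡∑ (λ v → if W v then 1 else 0) ⟩
    ∑ℕ (λ v → if W v then 1 else 0)         ≤⟨ ∑-mono (λ v → indicator≤1 (W v)) ⟩
    ∑ℕ {n} (λ _ → 1)                        ≡⟨ ∑-const {n} 1 ⟩
    n * 1                                   ≡⟨ ℕP.*-identityʳ n ⟩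
    n                                       ∎
    where
      open ℕP.≤-Reasoning
      indicator≤1 : ∀ b → (if b then 1 else 0) ≤ 1
      indicator≤1 true  = s≤s z≤n
      indicator≤1 false = z≤n

  size-allV : ∀ {n} → size {n} allV ≡ n
  size-allV {n} = trans (sumV≡∑ {n} (λ _ → 1)) (trans (∑-const {n} 1) (ℕP.*-identityʳ n))

  class-sizes : ∀ {n r} (part : Fin n → Fin r) → ∑ℕ (λ i → size (classOf part i)) ≡ n
  class-sizes part = trans (∑-partition part (λ _ → 1)) size-allV

  class-powSums : ∀ {n r} (G : SimpleGraph n) k (part : Fin n → Fin r)
    → ∑ℕ (λ i → powSum G k (classOf part i)) ≡ powSum G k allV
  class-powSums G k part = ∑-partition part (λ v → degree G v ^ k)

  small⇒powSum≤ : ∀ {n} (G : SimpleGraph n) k (W : VSet n) → δSmall G k W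
    → powSum G k W ≤ size W * (n ∸ size W) ^ k
  small⇒powSum≤ {n} G k W (_ , _ , bound) = toℚ-cancel-≤ (subst (toℚ (powSum G k W) ℚ.≤_)
    (sym (trans (toℚ-* (size W) ((n ∸ size W) ^ k)) (cong (toℚ (size W) ℚ.*_) (toℚ-^ (n ∸ size W) k))))
    bound)

  degree-power-bound : ∀ {n} (G : SimpleGraph n) j r' → j ≤ r' → (part : Fin n → Fin (suc r'))
    → (∀ i → δSmall G (suc j) (classOf part i))
    → suc r' ^ suc j * powSum G (suc j) allV ≤ n * (n * r') ^ suc j
  degree-power-bound {n} G j r' j≤r' part small = begin
    suc r' ^ k * powSum G k allV                        ≡⟨ cong (suc r' ^ k *_) (class-powSums G k part) ⟨
    suc r' ^ k * ∑ℕ (λ i → powSum G k (classOf part i)) ≤⟨ ℕP.*-monoʳ-≤ (suc r' ^ k) (∑-mono class-bound) ⟩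
    suc r' ^ k * ∑ℕ (λ i → a i * (n ∸ a i) ^ k)         ≤⟨ powerSum-bound n j a (λ i → n ∸ a i) a+b≡n (class-sizes part) j≤r' ⟩
    n * (n * r') ^ k                                    ∎
    where
      open ℕP.≤-Reasoning
      k = suc j
      a : Fin (suc r') → ℕ
      a i = size (classOf part i)
      class-bound : ∀ i → powSum G k (classOf part i) ≤ a i * (n ∸ a i) ^ k
      class-bound i = small⇒powSum≤ G k (classOf part i) (small i)
      a+b≡n : ∀ i → a i + (n ∸ a i) ≡ n
      a+b≡n i = ℕP.m+[n∸m]≡n (size≤n (classOf part i))

  small-classes⇒1≤n : ∀ {n r'} (G : SimpleGraph n) k (part : Fin n → Fin (suc r'))
    → (∀ i → δSmall G k (classOf part i)) → 1 ≤ size {n} allV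
  small-classes⇒1≤n {n} G k part small = begin
    1                          ≤⟨ proj₁ (small fzero) ⟩
    size (classOf part fzero)  ≤⟨ size≤n (classOf part fzero) ⟩
    n                          ≡⟨ size-allV ⟨
    size {n} allV              ∎
    where open ℕP.≤-Reasoning

  Dk-sandwich : ∀ {n} (G : SimpleGraph n) j (W : VSet n) {q X : ℚ} → 1 ≤ size W
    → GeDk G (suc j) W q → DkLe G (suc j) W X → q ℚ.≤ X
  Dk-sandwich G j W 1≤|W| (inj₁ q≤0) (0≤X , _)     = ℚP.≤-trans q≤0 0≤X
  Dk-sandwich G j W 1≤|W| (inj₂ lower) (0≤X , upper) = ^ℚ-cancel-≤ j 0≤X
    (ℚP.*-cancelˡ-≤-pos (toℚ (size W)) {{ℚ.positive (toℚ-pos (size W) 1≤|W|)}} (ℚP.≤-trans lower upper))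

open import Defs hiding (sym)
open import Data.Nat using (ℕ; suc; _≤_; _∸_; _*_; NonZero; z≤n; s≤s)
open import Data.Integer using (+_)
open import Data.Rational as ℚ using (ℚ; 0ℚ; _/_; _-_)
open import Data.Product using (_×_; _,_)
import Data.Rational.Properties as ℚP
open Rationals using (scaled-bound; ratio-bound)
open Partitions using (size-allV; degree-power-bound; small-classes⇒1≤n; Dk-sandwich)

theorem3p2 : (n : ℕ) (G : SimpleGraph n) (k r : ℕ) → 1 ≤ k → k ≤ r → .{{_ : NonZero r}}
    → (part : Fin n → Fin r)
    → (∀ i → δSmall G k (classOf part i))
    → DkLe G k allV (+ (n * (r ∸ 1)) / r)
    × (∀ (q : ℚ) → GeDk G k allV q → (h : 0ℚ ℚ.< toℚ n - q) → divPos (toℚ n) (toℚ n - q) h ℚ.≤ toℚ r)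
theorem3p2 n G (suc j) (suc r') (s≤s z≤n) (s≤s j≤r') part small = part-i , part-ii
  where
    X : ℚ
    X = + (n * r') / suc r'
    part-i : DkLe G (suc j) allV X
    part-i = ℚP.nonNegative⁻¹ X {{ℚP.normalize-nonNeg (n * r') (suc r')}}
           , subst (λ m → toℚ (powSum G (suc j) allV) ℚ.≤ toℚ m ℚ.* (X ^ℚ suc j)) (sym (size-allV {n}))
               (scaled-bound (powSum G (suc j) allV) n (n * r') r' (suc j)
                 (degree-power-bound G j r' j≤r' part small))
    part-ii : ∀ q → GeDk G (suc j) allV q → (h : 0ℚ ℚ.< toℚ n - q)
      → divPos (toℚ n) (toℚ n - q) h ℚ.≤ toℚ (suc r')
    part-ii q q≤Dk h = ratio-bound n r' q h
      (Dk-sandwich G j allV (small-classes⇒1≤n G (suc j) part small) q≤Dk part-i)
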